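{- For a positive integer $n \geq 2$, let $c(n)$ denote the number of unordered pairs $\{a,b\}$ of positive integers, written with $a \leq b$, such that $a + b = n$ and $b \geq 2^{a} - 1$ (that is, the number of ways a graph of order $n$ can be split into two connected components whose sizes satisfy Pálfy's inequality). Then for every positive integer $\alpha$, there are exactly $2^{\alpha}+1$ positive integers $n \geq 2$ such that $c(n) = \alpha$.
   Context: Motivation: for a finite solvable group $G$, the character degree graph $\Delta(G)$ has as vertices the primes dividing some irreducible character degree of $G$, with primes $p,q$ adjacent if $pq$ divides some irreducible character degree. If $\Delta(G)$ is disconnected, it has exactly two connected components, each complete, of sizes $a \leq b$, and Pálfy's inequality states $b \geq 2^{a}-1$. The order of a graph is its number of vertices. The statement above is purely arithmetic. -}

module Defs where

open import Data.Nat using (ℕ; suc; _∸_; _^_; _≤_; _≤?_)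
open import Data.Nat.Properties using ()
open import Data.List using (List; length; filter; upTo)
open import Data.Product using (_×_)
open import Relation.Nullary.Decidable using (_×-dec_)

Admissible : ℕ → ℕ → Set
Admissible n a = (1 ≤ a) × (a ≤ n ∸ a) × (2 ^ a ∸ 1 ≤ n ∸ a)

admissible? : (n a : ℕ) → Relation.Nullary.Decidable.Dec (Admissible n a)
admissible? n a = (1 ≤? a) ×-dec ((a ≤? n ∸ a) ×-dec (2 ^ a ∸ 1 ≤? n ∸ a))

-- c n = number of unordered pairs {a , b} of positive integers, a ≤ b,
-- a + b = n, b ≥ 2^a - 1.  Each such pair is determined by a ∈ {0, …, n}
-- (then b = n ∸ a, and a ≤ n ∸ a with a ≥ 1 forces a ≤ n, b ≥ 1, a + b = n).
c : ℕ → ℕ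
c n = length (filter (admissible? n) (upTo (suc n)))

{-# OPTIONS --safe #-}
module Submission where

open import Defs
open import Data.Nat using (ℕ; suc; _+_; _^_; _≤_)
open import Relation.Binary.PropositionalEquality using (_≡_)
open import Data.Fin using (Fin)
open import Data.Product using (Σ; _×_)
open import Function.Bundles using (_↔_)

open import Data.Nat using (zero; _∸_; _<_; z≤n; s≤s; s≤s⁻¹; s<s; s<s⁻¹; z<s; _≤?_)
open import Data.Nat.Properties
open import Data.Nat.Solver using (module +-*-Solver)
open import Data.Fin using (toℕ; fromℕ<)
open import Data.Fin.Properties using (toℕ<n; toℕ-fromℕ<; toℕ-injective)
open import Data.List using (length; filter; applyUpTo)
open import Data.List.Properties using (filter-none; filter-accept)
open import Data.List.Relation.Unary.All.Properties using (applyUpTo⁺₁)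
open import Data.Product using (_,_; proj₁; proj₂; ∃-syntax)
open import Data.Product.Properties using (Σ-≡,≡→≡)
open import Function.Base using (_∘_)
open import Function.Bundles using (_⇔_; mk⇔; mk↔ₛ′; module Equivalence)
open import Relation.Nullary using (yes; no; contradiction)
open import Relation.Nullary.Irrelevant using (Irrelevant)
open import Relation.Unary using (Pred; Decidable)
open import Relation.Binary.PropositionalEquality using (refl; sym; trans; cong; cong₂; subst; module ≡-Reasoning)

open Equivalence

-- The size a is admissible for n exactly when 1 ≤ a and threshold a = a + 2^a is
-- at most n + 1.  As threshold is strictly increasing, the admissible sizes are
-- 1, …, k for the k with threshold k ≤ n + 1 < threshold (k + 1).  Hence c n = α
-- exactly on an interval of values of n + 1 of length
-- threshold (α + 1) − threshold α = 2^α + 1, all with n ≥ 2 once α ≥ 1.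

length-filter-applyUpTo : ∀ {a p} {A : Set a} {P : Pred A p} (P? : Decidable P)
  (f : ℕ → A) {k m : ℕ} → k ≤ m → (∀ i → P (f i) ⇔ i < k) →
  length (filter P? (applyUpTo f m)) ≡ k
length-filter-applyUpTo P? f {zero} {m} _ P⇔ =
  cong length (filter-none P? (applyUpTo⁺₁ f m (λ {i} _ → n≮0 ∘ to (P⇔ i))))
length-filter-applyUpTo {P = P} P? f {suc k} {suc m} (s≤s k≤m) P⇔ = begin
  length (filter P? (applyUpTo f (suc m)))
    ≡⟨ cong length (filter-accept P? (from (P⇔ 0) z<s)) ⟩
  suc (length (filter P? (applyUpTo (f ∘ suc) m)))
    ≡⟨ cong suc (length-filter-applyUpTo P? (f ∘ suc) k≤m P∘suc⇔) ⟩
  suc k ∎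
  where
  open ≡-Reasoning
  P∘suc⇔ : ∀ i → P (f (suc i)) ⇔ i < k
  P∘suc⇔ i = mk⇔ (s<s⁻¹ ∘ to (P⇔ (suc i))) (from (P⇔ (suc i)) ∘ s<s)

∃-bracket : (f : ℕ → ℕ) → (∀ k → f k < f (suc k)) →
  ∀ x → f 0 ≤ x → ∃[ k ] f k ≤ x × x < f (suc k)
∃-bracket f f-inc zero f0≤0 = 0 , f0≤0 , ≤-<-trans z≤n (f-inc 0)
∃-bracket f f-inc (suc x) f0≤1+x with f 0 ≤? x
... | no f0≰x = 0 , f0≤1+x , ≤-<-trans (≰⇒> f0≰x) (f-inc 0)
... | yes f0≤x with ∃-bracket f f-inc x f0≤x
...   | k , fk≤x , x<fk+1 with suc x <? f (suc k)
...     | yes 1+x<fk+1 = k , m≤n⇒m≤1+n fk≤x , 1+x<fk+1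
...     | no 1+x≮fk+1 = suc k , ≮⇒≥ 1+x≮fk+1 , ≤-<-trans x<fk+1 (f-inc (suc k))

↔-interval : ∀ {p} {P : Pred ℕ p} (lo k : ℕ) → (∀ {n} → Irrelevant (P n)) →
  (∀ n → P n ⇔ (lo ≤ n × n < lo + k)) → Fin k ↔ Σ ℕ P
↔-interval {P = P} lo k P-irrelevant P⇔ = mk↔ₛ′ enum index enum∘index index∘enum
  where
  enum : Fin k → Σ ℕ P
  enum i = lo + toℕ i , from (P⇔ _) (m≤m+n lo (toℕ i) , +-monoʳ-< lo (toℕ<n i))

  offset< : ∀ {n} → P n → n ∸ lo < k
  offset< {n} p with to (P⇔ n) p
  ... | lo≤n , n<lo+k = subst (n ∸ lo <_) (m+n∸m≡n lo k) (∸-monoˡ-< n<lo+k lo≤n)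

  index : Σ ℕ P → Fin k
  index (_ , p) = fromℕ< (offset< p)

  enum∘index : ∀ np → enum (index np) ≡ np
  enum∘index (n , p) = Σ-≡,≡→≡ (lo+offset≡n , P-irrelevant _ p)
    where
    lo+offset≡n : lo + toℕ (index (n , p)) ≡ n
    lo+offset≡n = trans (cong (lo +_) (toℕ-fromℕ< (offset< p))) (m+[n∸m]≡n (proj₁ (to (P⇔ n) p)))

  index∘enum : ∀ i → index (enum i) ≡ i
  index∘enum i = toℕ-injective (trans (toℕ-fromℕ< _) (m+n∸m≡n lo (toℕ i)))

threshold : ℕ → ℕ
threshold a = a + 2 ^ a

n<2^n : ∀ n → n < 2 ^ n
n<2^n zero = z<s
n<2^n (suc n) = begin-strict
  suc n            <⟨ +-mono-≤-< (m^n>0 2 n) (n<2^n n) ⟩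
  2 ^ n + 2 ^ n    ≡⟨ cong (2 ^ n +_) (sym (+-identityʳ (2 ^ n))) ⟩
  2 ^ suc n        ∎
  where open ≤-Reasoning

threshold-suc : ∀ a → threshold (suc a) ≡ threshold a + (2 ^ a + 1)
threshold-suc a = solve 2 (λ a p → con 1 :+ a :+ (p :+ (p :+ con 0)) := a :+ p :+ (p :+ con 1)) refl a (2 ^ a)
  where open +-*-Solver

threshold-mono-≤ : ∀ {a b} → a ≤ b → threshold a ≤ threshold b
threshold-mono-≤ a≤b = +-mono-≤ a≤b (^-monoʳ-≤ 2 a≤b)

threshold-< : ∀ a → threshold a < threshold (suc a)
threshold-< a = +-mono-<-≤ (n<1+n a) (^-monoʳ-≤ 2 (n≤1+n a))

threshold-cancel-< : ∀ {a b} → threshold a < threshold b → a < b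
threshold-cancel-< {a} {b} ta<tb with a <? b
... | yes a<b = a<b
... | no a≮b = contradiction ta<tb (≤⇒≯ (threshold-mono-≤ (≮⇒≥ a≮b)))

threshold≡ : ∀ a → threshold a ≡ suc (2 ^ a ∸ 1 + a)
threshold≡ a = trans (+-comm a (2 ^ a)) (cong (_+ a) (sym (m+[n∸m]≡n (m^n>0 2 a))))

admissible⇔ : ∀ {n a} → Admissible n a ⇔ (1 ≤ a × threshold a ≤ suc n)
admissible⇔ {n} {a} = mk⇔ admissible⇒ admissible⇐
  where
  admissible⇒ : Admissible n a → 1 ≤ a × threshold a ≤ suc n
  admissible⇒ (1≤a , a≤n∸a , bound) = 1≤a , subst (_≤ suc n) (sym (threshold≡ a))
    (s≤s (m≤o∸n⇒m+n≤o _ (≤-trans a≤n∸a (m∸n≤m n a)) bound))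

  admissible⇐ : 1 ≤ a × threshold a ≤ suc n → Admissible n a
  admissible⇐ (1≤a , ta≤1+n) = 1≤a , m+n≤o⇒m≤o∸n a a+a≤n , m+n≤o⇒m≤o∸n _ bound
    where
    bound : 2 ^ a ∸ 1 + a ≤ n
    bound = s≤s⁻¹ (subst (_≤ suc n) (threshold≡ a) ta≤1+n)
    a+a≤n : a + a ≤ n
    a+a≤n = ≤-trans (+-monoˡ-≤ a (<⇒≤pred (n<2^n a))) bound

bracket⇒c≡ : ∀ {n α} → threshold α ≤ suc n → suc n < threshold (suc α) → c n ≡ α
bracket⇒c≡ {n} {α} tα≤1+n 1+n<tα+1 =
  -- upTo (suc n) is 0 ∷ applyUpTo suc n and admissible? n 0 computes to no.
  length-filter-applyUpTo (admissible? n) suc α≤n admissible-suc⇔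
  where
  α≤n : α ≤ n
  α≤n = s≤s⁻¹ (≤-trans (≤-trans (n<2^n α) (m≤n+m _ α)) tα≤1+n)
  admissible-suc⇔ : ∀ i → Admissible n (suc i) ⇔ i < α
  admissible-suc⇔ i = mk⇔
    (λ adm → s<s⁻¹ (threshold-cancel-< (≤-<-trans (proj₂ (to admissible⇔ adm)) 1+n<tα+1)))
    (λ i<α → from admissible⇔ (s≤s z≤n , ≤-trans (threshold-mono-≤ i<α) tα≤1+n))

c≡⇔bracket : ∀ {n α} → c n ≡ α ⇔ (threshold α ≤ suc n × suc n < threshold (suc α))
c≡⇔bracket {n} = mk⇔ c≡⇒bracket (λ (lo , hi) → bracket⇒c≡ lo hi)
  where
  c≡⇒bracket : ∀ {α} → c n ≡ α → threshold α ≤ suc n × suc n < threshold (suc α)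
  c≡⇒bracket refl with ∃-bracket threshold threshold-< (suc n) (s≤s z≤n)
  ... | k , lo , hi rewrite bracket⇒c≡ {n} {k} lo hi = lo , hi

mainTheorem1 : (α : ℕ) → 1 ≤ α →
    Fin (2 ^ α + 1) ↔ Σ ℕ (λ n → (2 ≤ n) × (c n ≡ α))
mainTheorem1 α@(suc β) _ = ↔-interval lo (2 ^ α + 1) irrelevant solutions⇔
  where
  irrelevant : ∀ {n} → Irrelevant (2 ≤ n × c n ≡ α)
  irrelevant (p , e) (q , e′) = cong₂ _,_ (≤-irrelevant p q) (≡-irrelevant e e′)

  -- threshold α reduces to suc lo.
  lo : ℕ
  lo = β + 2 ^ α

  solutions⇔ : ∀ n → (2 ≤ n × c n ≡ α) ⇔ (lo ≤ n × n < lo + (2 ^ α + 1))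
  solutions⇔ n = mk⇔ solution⇒ solution⇐
    where
    solution⇒ : 2 ≤ n × c n ≡ α → lo ≤ n × n < lo + (2 ^ α + 1)
    solution⇒ (_ , cn≡α) with to (c≡⇔bracket {n} {α}) cn≡α
    ... | tα≤1+n , 1+n<tα+1 = s≤s⁻¹ tα≤1+n , s<s⁻¹ (subst (suc n <_) (threshold-suc α) 1+n<tα+1)

    solution⇐ : lo ≤ n × n < lo + (2 ^ α + 1) → 2 ≤ n × c n ≡ α
    solution⇐ (lo≤n , n<lo+k) =
      s≤s⁻¹ (≤-trans (threshold-mono-≤ {1} {α} (s≤s z≤n)) (s≤s lo≤n)) ,
      from (c≡⇔bracket {n} {α}) (s≤s lo≤n , subst (suc n <_) (sym (threshold-suc α)) (s<s n<lo+k))
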